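{- Let $(a_n)_{n\ge1}$ be a sequence of positive integers and let $l\ge0$, $r\ge1$ be integers with $a_n=a_{n+r}$ for all $n>l$. Let $s=a_{l+1}+\cdots+a_{l+r}$ and $D=B_{l+1}^{l+r-1}$. Then for every integer $k\ge0$, $$B_{rk+l}=3^{rk}B_l+2^{b_l}D\,\frac{3^{rk}-2^{sk}}{3^r-2^s}.$$
   Context: $b_0=0$, $b_n=\sum_{i=1}^n a_i$, $B_n=\sum_{i=0}^{n-1}3^{n-1-i}2^{b_i}$ (so $B_0=0$). For $u\ge1$, $v\ge u-1$: $b_u^v=\sum_{i=u}^va_i$ and $B_u^v=\sum_{j=u-1}^{v}3^{v-j}2^{b_u^j}$; thus $D=B_{l+1}^{l+r-1}=\sum_{j=l}^{l+r-1}3^{l+r-1-j}2^{b_{l+1}^j}$. -}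

module Defs where

open import Data.Nat using (ℕ; zero; suc; _+_; _*_; _∸_; _^_)

sumTo : ℕ → (ℕ → ℕ) → ℕ
sumTo zero    f = 0
sumTo (suc n) f = sumTo n f + f n

-- b_n = Σ_{i=1}^{n} a_i   (a 0 is unused; the sequence is indexed from 1)
b : (ℕ → ℕ) → ℕ → ℕ
b a n = sumTo n (λ i → a (suc i))

B : (ℕ → ℕ) → ℕ → ℕ
B a n = sumTo n (λ i → 3 ^ (n ∸ 1 ∸ i) * 2 ^ b a i)

-- b_u^v = Σ_{i=u}^{v} a_i  (meaningful for u ≥ 1, v ≥ u - 1; empty sum when v = u - 1)
bUV : (ℕ → ℕ) → ℕ → ℕ → ℕ
bUV a u v = sumTo (suc v ∸ u) (λ i → a (u + i))

-- B_u^v = Σ_{j=u-1}^{v} 3^{v-j} 2^{b_u^j}  (meaningful for u ≥ 1, v ≥ u - 1)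
BUV : (ℕ → ℕ) → ℕ → ℕ → ℕ
BUV a u v = sumTo (suc v ∸ (u ∸ 1))
  (λ i → 3 ^ (v ∸ ((u ∸ 1) + i)) * 2 ^ bUV a u ((u ∸ 1) + i))

module Submission where

-- Write  S = a_{l+1} + ... + a_{l+r}  and  D = B_{l+1}^{l+r-1}.  The proof has
-- three layers.
--   1. Splitting.  B is a Horner sum with base 3, hence for all n, m
--        B_{n+m} = 3^m B_n + 2^{b_n} B_{n+1}^{n+m-1},   b_{n+m} = b_n + b_{n+1}^{n+m}.
--   2. Periodicity.  Since a_n = a_{n+r} for n > l, the tail sums starting at
--      rk + l do not depend on k; so b_{rk+l} = b_l + S k and, by splitting with
--      n = rk + l, m = r, the sequence x_k = B_{rk+l} satisfies
--        x_{k+1} = 3^r x_k + 2^{b_l} D (2^S)^k.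
--   3. Linear recurrences.  In ℤ, x_{k+1} = t x_k + c s^k
--      implies  x_k (t - s) = t^k x_0 (t - s) + c (t^k - s^k)  (geometric sum).
-- The theorem is 3. applied over ℤ to 2., after identifying the paper's
-- b_u^v and B_u^v with the tail sums used here.

open import Defs
open import Data.Nat using (ℕ; suc; _<_; _≤_)
open import Data.Integer using (ℤ; +_; _-_; _*_; _+_)
import Data.Nat as N
open import Relation.Binary.PropositionalEquality using (_≡_)

open import Data.Nat using (zero; s≤s)
open import Data.Integer using (_^_)
import Data.Nat.Properties as NP
import Data.Integer.Properties as ZP
open import Relation.Binary.PropositionalEquality using (refl; sym; trans; cong; cong₂; module ≡-Reasoning)
import Data.Nat.Tactic.RingSolver as NS
import Data.Integer.Tactic.RingSolver as ZS

open ≡-Reasoning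

sumTo-cong : ∀ n (f g : ℕ → ℕ) → (∀ i → i < n → f i ≡ g i) → sumTo n f ≡ sumTo n g
sumTo-cong zero    f g f≗g = refl
sumTo-cong (suc n) f g f≗g =
  cong₂ N._+_ (sumTo-cong n f g (λ i i<n → f≗g i (NP.m<n⇒m<1+n i<n))) (f≗g n NP.≤-refl)

sumTo-*ˡ : ∀ n c (f : ℕ → ℕ) → sumTo n (λ i → c N.* f i) ≡ c N.* sumTo n f
sumTo-*ˡ zero    c f = sym (NP.*-zeroʳ c)
sumTo-*ˡ (suc n) c f = begin
  sumTo n (λ i → c N.* f i) N.+ c N.* f n ≡⟨ cong (N._+ c N.* f n) (sumTo-*ˡ n c f) ⟩
  c N.* sumTo n f N.+ c N.* f n           ≡⟨ sym (NP.*-distribˡ-+ c (sumTo n f) (f n)) ⟩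
  c N.* (sumTo n f N.+ f n)               ∎

-- horner f m = Σ_{i<m} 3^{m-1-i} f i; by definition  B a = horner (λ i → 2^{b_i}).
horner : (ℕ → ℕ) → ℕ → ℕ
horner f m = sumTo m (λ i → 3 N.^ (m N.∸ 1 N.∸ i) N.* f i)

horner-suc : ∀ f m → horner f (suc m) ≡ 3 N.* horner f m N.+ f m
horner-suc f zero    = NP.+-identityʳ (f 0)
horner-suc f (suc m) = cong₂ N._+_ shifted last
  where
  shifted : sumTo (suc m) (λ i → 3 N.^ (suc m N.∸ i) N.* f i) ≡ 3 N.* horner f (suc m)
  shifted = trans (sumTo-cong (suc m) _ _ (λ i i≤m →
              trans (cong (λ e → 3 N.^ e N.* f i) (NP.+-∸-assoc 1 (NP.≤-pred i≤m)))
                    (NP.*-assoc 3 (3 N.^ (m N.∸ i)) (f i))))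
            (sumTo-*ˡ (suc m) 3 (λ i → 3 N.^ (m N.∸ i) N.* f i))
  last : 3 N.^ (m N.∸ m) N.* f (suc m) ≡ f (suc m)
  last rewrite NP.n∸n≡0 m = NP.+-identityʳ (f (suc m))

horner-cong : ∀ (f g : ℕ → ℕ) m → (∀ i → f i ≡ g i) → horner f m ≡ horner g m
horner-cong f g m f≗g = sumTo-cong m _ _ (λ i _ → cong (3 N.^ (m N.∸ 1 N.∸ i) N.*_) (f≗g i))

-- bFrom a n i = a_{n+1} + ... + a_{n+i}  (= b_{n+1}^{n+i}).
bFrom : (ℕ → ℕ) → ℕ → ℕ → ℕ
bFrom a n i = sumTo i (λ j → a (suc (n N.+ j)))

-- BFrom a n m = Σ_{i<m} 3^{m-1-i} 2^{b_{n+1}^{n+i}}  (= B_{n+1}^{n+m-1}).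
BFrom : (ℕ → ℕ) → ℕ → ℕ → ℕ
BFrom a n m = horner (λ i → 2 N.^ bFrom a n i) m

b-split : ∀ a n m → b a (n N.+ m) ≡ b a n N.+ bFrom a n m
b-split a n zero    = trans (cong (b a) (NP.+-identityʳ n)) (sym (NP.+-identityʳ _))
b-split a n (suc m) rewrite NP.+-suc n m | b-split a n m =
  NP.+-assoc (b a n) (bFrom a n m) (a (suc (n N.+ m)))

-- Splitting B at position n: the first n terms are shifted m places by Horner's rule.
B-split : ∀ a n m → B a (n N.+ m) ≡ 3 N.^ m N.* B a n N.+ 2 N.^ b a n N.* BFrom a n m
B-split a n zero rewrite NP.+-identityʳ n | NP.*-zeroʳ (2 N.^ b a n) =
  sym (trans (NP.+-identityʳ _) (NP.*-identityˡ (B a n)))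
B-split a n (suc m) rewrite NP.+-suc n m = begin
  B a (suc (n N.+ m))
    ≡⟨ horner-suc (λ i → 2 N.^ b a i) (n N.+ m) ⟩
  3 N.* B a (n N.+ m) N.+ 2 N.^ b a (n N.+ m)
    ≡⟨ cong₂ (λ x y → 3 N.* x N.+ 2 N.^ y) (B-split a n m) (b-split a n m) ⟩
  3 N.* (3 N.^ m N.* B a n N.+ E N.* BFrom a n m) N.+ 2 N.^ (b a n N.+ bFrom a n m)
    ≡⟨ cong (3 N.* (3 N.^ m N.* B a n N.+ E N.* BFrom a n m) N.+_)
            (NP.^-distribˡ-+-* 2 (b a n) (bFrom a n m)) ⟩
  3 N.* (3 N.^ m N.* B a n N.+ E N.* BFrom a n m) N.+ E N.* 2 N.^ bFrom a n m
    ≡⟨ regroup (3 N.^ m) (B a n) E (BFrom a n m) (2 N.^ bFrom a n m) ⟩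
  3 N.* 3 N.^ m N.* B a n N.+ E N.* (3 N.* BFrom a n m N.+ 2 N.^ bFrom a n m)
    ≡⟨ cong (λ y → 3 N.* 3 N.^ m N.* B a n N.+ E N.* y)
            (sym (horner-suc (λ i → 2 N.^ bFrom a n i) m)) ⟩
  3 N.* 3 N.^ m N.* B a n N.+ E N.* BFrom a n (suc m) ∎
  where
  E : ℕ
  E = 2 N.^ b a n
  regroup : ∀ T X E C F → 3 N.* (T N.* X N.+ E N.* C) N.+ E N.* F
                        ≡ 3 N.* T N.* X N.+ E N.* (3 N.* C N.+ F)
  regroup = NS.solve-∀

bUV-as-bFrom : ∀ a l m → bUV a (suc l) (l N.+ m) ≡ bFrom a l m
bUV-as-bFrom a l m = cong (λ n → sumTo n (λ i → a (suc (l N.+ i)))) (NP.m+n∸m≡n l m)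

BUV-as-BFrom : ∀ a l m → BUV a (suc l) (l N.+ m) ≡ BFrom a l (suc m)
BUV-as-BFrom a l m = begin
  BUV a (suc l) (l N.+ m)
    ≡⟨ cong (λ n → sumTo n term) (trans (cong (N._∸ l) (sym (NP.+-suc l m))) (NP.m+n∸m≡n l (suc m))) ⟩
  sumTo (suc m) term
    ≡⟨ sumTo-cong (suc m) _ _ (λ i _ → cong₂ (λ e x → 3 N.^ e N.* 2 N.^ x)
                                        (NP.[m+n]∸[m+o]≡n∸o l m i) (bUV-as-bFrom a l i)) ⟩
  BFrom a l (suc m) ∎
  where
  term : ℕ → ℕ
  term i = 3 N.^ (l N.+ m N.∸ (l N.+ i)) N.* 2 N.^ bUV a (suc l) (l N.+ i)

pos-^ : ∀ m n → + (m N.^ n) ≡ (+ m) ^ n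
pos-^ m zero    = refl
pos-^ m (suc n) = trans (ZP.pos-* m (m N.^ n)) (cong (+ m *_) (pos-^ m n))

module Periodic (a : ℕ → ℕ) (l r : ℕ) (periodic : ∀ n → l < n → a n ≡ a (n N.+ r)) where

  next-period : ∀ k → r N.* suc k N.+ l ≡ (r N.* k N.+ l) N.+ r
  next-period k = solve r k l
    where
    solve : ∀ r k l → r N.* (1 N.+ k) N.+ l ≡ (r N.* k N.+ l) N.+ r
    solve = NS.solve-∀

  a-periodic : ∀ n → l < n → ∀ k → a (n N.+ r N.* k) ≡ a n
  a-periodic n l<n zero    = cong a (trans (cong (n N.+_) (NP.*-zeroʳ r)) (NP.+-identityʳ n))
  a-periodic n l<n (suc k) = begin
    a (n N.+ r N.* suc k)     ≡⟨ cong a (shift n r k) ⟩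
    a (n N.+ r N.* k N.+ r)   ≡⟨ sym (periodic (n N.+ r N.* k) (NP.<-≤-trans l<n (NP.m≤m+n n _))) ⟩
    a (n N.+ r N.* k)         ≡⟨ a-periodic n l<n k ⟩
    a n                       ∎
    where
    shift : ∀ n r k → n N.+ r N.* (1 N.+ k) ≡ n N.+ r N.* k N.+ r
    shift = NS.solve-∀

  bFrom-periodic : ∀ k i → bFrom a (r N.* k N.+ l) i ≡ bFrom a l i
  bFrom-periodic k i = sumTo-cong i _ _ (λ j _ →
    trans (cong a (reindex (r N.* k) l j)) (a-periodic (suc (l N.+ j)) (s≤s (NP.m≤m+n l j)) k))
    where
    reindex : ∀ x l j → suc (x N.+ l N.+ j) ≡ suc (l N.+ j) N.+ x
    reindex = NS.solve-∀

  BFrom-periodic : ∀ k m → BFrom a (r N.* k N.+ l) m ≡ BFrom a l m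
  BFrom-periodic k m = horner-cong _ _ m (λ i → cong (2 N.^_) (bFrom-periodic k i))

  b-periodic : ∀ k → b a (r N.* k N.+ l) ≡ b a l N.+ bFrom a l r N.* k
  b-periodic zero    rewrite NP.*-zeroʳ r | NP.*-zeroʳ (bFrom a l r) = sym (NP.+-identityʳ (b a l))
  b-periodic (suc k) = begin
    b a (r N.* suc k N.+ l)                       ≡⟨ cong (b a) (next-period k) ⟩
    b a (r N.* k N.+ l N.+ r)                     ≡⟨ b-split a (r N.* k N.+ l) r ⟩
    b a (r N.* k N.+ l) N.+ bFrom a (r N.* k N.+ l) r
                                                  ≡⟨ cong₂ N._+_ (b-periodic k) (bFrom-periodic k r) ⟩
    b a l N.+ S N.* k N.+ S                       ≡⟨ add-period (b a l) S k ⟩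
    b a l N.+ S N.* suc k                         ∎
    where
    S : ℕ
    S = bFrom a l r
    add-period : ∀ x S k → x N.+ S N.* k N.+ S ≡ x N.+ S N.* (1 N.+ k)
    add-period = NS.solve-∀

  B-recurrence : ∀ k → B a (r N.* suc k N.+ l)
    ≡ 3 N.^ r N.* B a (r N.* k N.+ l) N.+ 2 N.^ b a l N.* BFrom a l r N.* (2 N.^ bFrom a l r) N.^ k
  B-recurrence k = begin
    B a (r N.* suc k N.+ l)
      ≡⟨ cong (B a) (next-period k) ⟩
    B a (r N.* k N.+ l N.+ r)
      ≡⟨ B-split a (r N.* k N.+ l) r ⟩
    3 N.^ r N.* B a (r N.* k N.+ l) N.+ 2 N.^ b a (r N.* k N.+ l) N.* BFrom a (r N.* k N.+ l) r
      ≡⟨ cong₂ (λ e d → 3 N.^ r N.* B a (r N.* k N.+ l) N.+ 2 N.^ e N.* d)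
               (b-periodic k) (BFrom-periodic k r) ⟩
    3 N.^ r N.* B a (r N.* k N.+ l) N.+ 2 N.^ (b a l N.+ S N.* k) N.* D
      ≡⟨ cong (λ p → 3 N.^ r N.* B a (r N.* k N.+ l) N.+ p N.* D)
              (trans (NP.^-distribˡ-+-* 2 (b a l) (S N.* k)) (cong (2 N.^ b a l N.*_) (sym (NP.^-*-assoc 2 S k)))) ⟩
    3 N.^ r N.* B a (r N.* k N.+ l) N.+ 2 N.^ b a l N.* (2 N.^ S) N.^ k N.* D
      ≡⟨ cong (3 N.^ r N.* B a (r N.* k N.+ l) N.+_) (swap (2 N.^ b a l) ((2 N.^ S) N.^ k) D) ⟩
    3 N.^ r N.* B a (r N.* k N.+ l) N.+ 2 N.^ b a l N.* D N.* (2 N.^ S) N.^ k ∎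
    where
    S D : ℕ
    S = bFrom a l r
    D = BFrom a l r
    swap : ∀ x y z → x N.* y N.* z ≡ x N.* z N.* y
    swap = NS.solve-∀

  -- The same recurrence read in ℤ, in the shape required by linear-recurrence.
  B-recurrenceℤ : ∀ k → + B a (r N.* suc k N.+ l)
    ≡ + (3 N.^ r) * + B a (r N.* k N.+ l) + (+ (2 N.^ b a l) * + BFrom a l r) * (+ (2 N.^ bFrom a l r)) ^ k
  B-recurrenceℤ k = begin
    + B a (r N.* suc k N.+ l)
      ≡⟨ cong +_ (B-recurrence k) ⟩
    + (T N.* X N.+ E N.* D N.* Q)
      ≡⟨ ZP.pos-+ (T N.* X) (E N.* D N.* Q) ⟩
    + (T N.* X) + + (E N.* D N.* Q)
      ≡⟨ cong₂ _+_ (ZP.pos-* T X)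
                   (trans (ZP.pos-* (E N.* D) Q) (cong₂ _*_ (ZP.pos-* E D) (pos-^ (2 N.^ bFrom a l r) k))) ⟩
    + T * + X + (+ E * + D) * (+ (2 N.^ bFrom a l r)) ^ k ∎
    where
    T X E D Q : ℕ
    T = 3 N.^ r
    X = B a (r N.* k N.+ l)
    E = 2 N.^ b a l
    D = BFrom a l r
    Q = (2 N.^ bFrom a l r) N.^ k

linear-recurrence : (x : ℕ → ℤ) (t s c : ℤ) → (∀ k → x (suc k) ≡ t * x k + c * s ^ k) →
  ∀ k → x k * (t - s) ≡ t ^ k * x 0 * (t - s) + c * (t ^ k - s ^ k)
linear-recurrence x t s c step zero = base (x 0) t s c
  where
  base : ∀ x t s c → x * (t - s) ≡ + 1 * x * (t - s) + c * (+ 1 - + 1)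
  base = ZS.solve-∀
linear-recurrence x t s c step (suc k) = begin
  x (suc k) * (t - s)
    ≡⟨ cong (_* (t - s)) (step k) ⟩
  (t * x k + c * s ^ k) * (t - s)
    ≡⟨ expand t (x k) c (s ^ k) s ⟩
  t * (x k * (t - s)) + c * s ^ k * (t - s)
    ≡⟨ cong (λ y → t * y + c * s ^ k * (t - s)) (linear-recurrence x t s c step k) ⟩
  t * (t ^ k * x 0 * (t - s) + c * (t ^ k - s ^ k)) + c * s ^ k * (t - s)
    ≡⟨ collect t (t ^ k) (x 0) s (s ^ k) c ⟩
  t * t ^ k * x 0 * (t - s) + c * (t * t ^ k - s * s ^ k) ∎
  where
  expand : ∀ t y c q s → (t * y + c * q) * (t - s) ≡ t * (y * (t - s)) + c * q * (t - s)
  expand = ZS.solve-∀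
  collect : ∀ t p x₀ s q c → t * (p * x₀ * (t - s) + c * (p - q)) + c * q * (t - s)
                           ≡ t * p * x₀ * (t - s) + c * (t * p - s * q)
  collect = ZS.solve-∀

pos-^-* : ∀ m r k → (+ (m N.^ r)) ^ k ≡ + (m N.^ (r N.* k))
pos-^-* m r k = trans (sym (pos-^ (m N.^ r) k)) (cong +_ (NP.^-*-assoc m r k))

proposition3p2 : (a : ℕ → ℕ) → (∀ n → 1 ≤ n → 1 ≤ a n) → (l r : ℕ) → 1 ≤ r →
    (∀ n → l < n → a n ≡ a (n N.+ r)) →
    let s = bUV a (suc l) (l N.+ r)
        D = BUV a (suc l) (l N.+ r N.∸ 1)
    in (k : ℕ) →
      (+ B a (r N.* k N.+ l)) * (+ (3 N.^ r) - + (2 N.^ s))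
        ≡ (+ (3 N.^ (r N.* k))) * (+ B a l) * (+ (3 N.^ r) - + (2 N.^ s))
          + (+ (2 N.^ b a l)) * (+ D) * (+ (3 N.^ (r N.* k)) - + (2 N.^ (s N.* k)))
proposition3p2 a _ l (suc r) _ periodic k
  rewrite bUV-as-bFrom a l (suc r) | NP.+-suc l r | BUV-as-BFrom a l r = begin
    x k * (t - s)
      ≡⟨ linear-recurrence x t s c B-recurrenceℤ k ⟩
    t ^ k * x 0 * (t - s) + c * (t ^ k - s ^ k)
      ≡⟨ cong (λ x₀ → t ^ k * x₀ * (t - s) + c * (t ^ k - s ^ k))
              (cong (λ n → + B a (n N.+ l)) (NP.*-zeroʳ (suc r))) ⟩
    t ^ k * + B a l * (t - s) + c * (t ^ k - s ^ k)
      ≡⟨ cong₂ (λ p q → p * + B a l * (t - s) + c * (p - q)) (pos-^-* 3 (suc r) k) (pos-^-* 2 S k) ⟩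
    + (3 N.^ (suc r N.* k)) * + B a l * (t - s) + c * (+ (3 N.^ (suc r N.* k)) - + (2 N.^ (S N.* k))) ∎
  where
  open Periodic a l (suc r) periodic
  S : ℕ
  S = bFrom a l (suc r)
  x : ℕ → ℤ
  x k = + B a (suc r N.* k N.+ l)
  t s c : ℤ
  t = + (3 N.^ suc r)
  s = + (2 N.^ S)
  c = + (2 N.^ b a l) * + BFrom a l (suc r)
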